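{- Let $T$ be a text of length $n$, let $p^+_1<\dots<p^+_r<p^+_{r+1}=n+1$ be defined by $\{p^+_1,\dots,p^+_r,p^+_{r+1}\}=\{SA[l_1],\dots,SA[l_r],n+1\}$, and let $I_\phi$ be the sequence of $r$ pairs $(p^+_1,\phi(p^+_1)),(p^+_2,\phi(p^+_2)),\dots,(p^+_r,\phi(p^+_r))$. Then (i) $I_\phi$ is a disjoint interval sequence, and (ii) $\phi$ is equal to the bijective function represented by $I_\phi$.
   Context: $T=T[1]\cdots T[n]$ is a string whose last character $T[n]=\$$ is lexicographically smallest and unique. $SA$ is its suffix array, the BWT $L$ has $L[i]=T[SA[i]-1]$ ($L[i]=T[n]$ if $SA[i]=1$), $L$ has $r$ maximal runs and $l_j$ is the starting position of the $j$-th run. $\phi(i)=SA[k-1]$ where $SA[k]=i$ ($\phi(i)=SA[n]$ if $i=SA[1]$). A sequence $I=(p_1,q_1),\dots,(p_k,q_k)$ of integer pairs, with $p_{k+1}:=n+1$, is a disjoint interval sequence iff there is a permutation $\pi$ of $[1,k]$ such that (a) $p_1=1<p_2<\dots<p_k\le n$, (b) $q_{\pi[1]}=1$, and (c) $q_{\pi[i]}=q_{\pi[i-1]}+(p_{\pi[i-1]+1}-p_{\pi[i-1]})$ for $i\in[2,k]$. The bijective function $f:[1,n]\to[1,n]$ represented by $I$ is $f(i)=q_x+(i-p_x)$ where $x$ is the integer with $p_x\le i<p_{x+1}$. -}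

module Defs where

open import Data.Nat using (ℕ; zero; suc; _+_; _∸_; _≤_; _<_; _≡ᵇ_)
open import Data.Nat.Properties using (≤-decTotalOrder)
open import Data.Bool using (Bool; true; false; if_then_else_; not)
open import Data.List using (List; []; _∷_; map; applyUpTo; filterᵇ; length)
open import Data.Product using (_×_; _,_; proj₁; proj₂; Σ; ∃)
open import Relation.Binary.PropositionalEquality using (_≡_)
open import Relation.Nullary using (¬_)
open import Relation.Nullary.Decidable using (does)
open import Data.List.Relation.Binary.Lex.Strict using (Lex-<)
open import Data.List.Sort ≤-decTotalOrder using (sort)

-- Conventions: positions are 1-indexed natural numbers; a text of length n
-- is a function T : ℕ → ℕ of which only T 1 … T n matter; characters are
-- natural numbers ordered by the usual order.

suffix : (ℕ → ℕ) → ℕ → ℕ → List ℕ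
suffix T n i = map T (applyUpTo (λ m → i + m) (suc n ∸ i))

_<ˢ_ : List ℕ → List ℕ → Set
xs <ˢ ys = Lex-< _≡_ _<_ xs ys

-- T[n] = $ is the unique, lexicographically smallest character
IsText : ℕ → (ℕ → ℕ) → Set
IsText n T = 1 ≤ n × (∀ i → 1 ≤ i → i < n → T n < T i)

IsSuffixArray : ℕ → (ℕ → ℕ) → (ℕ → ℕ) → Set
IsSuffixArray n T SA =
    (∀ k → 1 ≤ k → k ≤ n → 1 ≤ SA k × SA k ≤ n)
  × (∀ k k' → 1 ≤ k → k ≤ n → 1 ≤ k' → k' ≤ n → SA k ≡ SA k' → k ≡ k')
  × (∀ k k' → 1 ≤ k → k < k' → k' ≤ n → suffix T n (SA k) <ˢ suffix T n (SA k'))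

BWT : ℕ → (ℕ → ℕ) → (ℕ → ℕ) → ℕ → ℕ
BWT n T SA i = if SA i ≡ᵇ 1 then T n else T (SA i ∸ 1)

range1 : ℕ → List ℕ
range1 n = applyUpTo suc n

isRunStart : (ℕ → ℕ) → ℕ → Bool
isRunStart L zero = false
isRunStart L (suc zero) = true
isRunStart L (suc (suc i)) = not (L (suc (suc i)) ≡ᵇ L (suc i))

runStarts : ℕ → (ℕ → ℕ) → List ℕ
runStarts n L = filterᵇ (isRunStart L) (range1 n)

-- inverse suffix array: the k ∈ [1,m] with SA k = i (0 if none)
invSearch : (ℕ → ℕ) → ℕ → ℕ → ℕ
invSearch SA zero i = 0
invSearch SA (suc k) i = if SA (suc k) ≡ᵇ i then suc k else invSearch SA k i

phi : ℕ → (ℕ → ℕ) → ℕ → ℕ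
phi n SA i = if invSearch SA n i ≡ᵇ 1 then SA n else SA (invSearch SA n i ∸ 1)

pPlus : ℕ → (ℕ → ℕ) → (ℕ → ℕ) → List ℕ
pPlus n T SA = sort (map SA (runStarts n (BWT n T SA)))

Iphi : ℕ → (ℕ → ℕ) → (ℕ → ℕ) → List (ℕ × ℕ)
Iphi n T SA = map (λ p → (p , phi n SA p)) (pPlus n T SA)

-- 1-indexed access to a list of pairs (default (0,0) out of range)
at : List (ℕ × ℕ) → ℕ → ℕ × ℕ
at [] x = (0 , 0)
at (a ∷ as) zero = (0 , 0)
at (a ∷ as) (suc zero) = a
at (a ∷ as) (suc (suc x)) = at as (suc x)

pOf : ℕ → List (ℕ × ℕ) → ℕ → ℕ
pOf n I x = if x ≡ᵇ suc (length I) then suc n else proj₁ (at I x)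

qOf : List (ℕ × ℕ) → ℕ → ℕ
qOf I x = proj₂ (at I x)

IsPerm : ℕ → (ℕ → ℕ) → Set
IsPerm k π =
    (∀ i → 1 ≤ i → i ≤ k → 1 ≤ π i × π i ≤ k)
  × (∀ i j → 1 ≤ i → i ≤ k → 1 ≤ j → j ≤ k → π i ≡ π j → i ≡ j)
  × (∀ j → 1 ≤ j → j ≤ k → Σ ℕ λ i → 1 ≤ i × i ≤ k × π i ≡ j)

IsDisjointIntervalSequence : ℕ → List (ℕ × ℕ) → Set
IsDisjointIntervalSequence n I =
  Σ (ℕ → ℕ) λ π → IsPerm k π
    × (pOf n I 1 ≡ 1
       × (∀ x → 1 ≤ x → x < k → pOf n I x < pOf n I (suc x))
       × pOf n I k ≤ n)
    × qOf I (π 1) ≡ 1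
    × (∀ i → 2 ≤ i → i ≤ k →
         qOf I (π i) ≡ qOf I (π (i ∸ 1))
                       + (pOf n I (suc (π (i ∸ 1))) ∸ pOf n I (π (i ∸ 1))))
  where
  k : ℕ
  k = length I

Represents : ℕ → List (ℕ × ℕ) → (ℕ → ℕ) → Set
Represents n I g =
  ∀ i x → 1 ≤ i → i ≤ n → 1 ≤ x → x ≤ length I →
    pOf n I x ≤ i → i < pOf n I (suc x) →
    g i ≡ qOf I x + (i ∸ pOf n I x)

module Submission where

-- φ sends SA[k] to SA[k-1].  If k does not start a run of L, then L[k-1] = L[k], and the
-- LF-mapping sends the SA-neighbours SA[k-1], SA[k] to the SA-neighbours SA[k-1]-1, SA[k]-1;
-- that is, φ(j) = φ(j-1) + 1 for every j ≥ 2 that is not one of the p⁺.  So φ is a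
-- translation on each interval [p⁺_x, p⁺_{x+1}), which is (ii).  Since φ is a bijection of
-- [1,n], the images of these intervals are blocks of consecutive values tiling [1,n]; the
-- block after that of x starts at q_x + (p⁺_{x+1} - p⁺_x), and listing the blocks by their
-- first value gives the permutation π of (i).

open import Defs
open import Data.Bool using (true; false; not; if_then_else_)
import Data.Bool as Bool
open import Data.Bool.Properties using (if-float)
open import Data.Empty using (⊥)
open import Data.Fin using (Fin; toℕ; fromℕ<)
open import Data.Fin.Properties using (toℕ<n; toℕ-fromℕ<; toℕ-injective; injective⇒≤; punchOut-injective)
open import Data.List using (List; []; _∷_; length; map; applyUpTo; upTo)
open import Data.List.Properties using (map-upTo; map-cong)
open import Data.List.Membership.Propositional using (_∈_)
open import Data.List.Membership.Propositional.Properties using (∈-map⁺; ∈-filter⁺; ∈-applyUpTo⁺)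
import Data.List.Relation.Binary.Lex.Core as Lex
open import Data.List.Relation.Binary.Lex.Strict using (xs≮[]; <-transitive; <-asymmetric)
open import Data.List.Relation.Binary.Permutation.Propositional using (_↭_; ↭-sym; ↭⇒↭ₛ)
open import Data.List.Relation.Binary.Permutation.Propositional.Properties using (All-resp-↭; Any-resp-↭)
open import Data.List.Relation.Unary.All as All using (All; _∷_)
import Data.List.Relation.Unary.All.Properties as Allₚ
open import Data.List.Relation.Unary.AllPairs as AllPairs using (AllPairs; _∷_)
import Data.List.Relation.Unary.AllPairs.Properties as AllPairsₚ
open import Data.List.Relation.Unary.Any using (here; there)
open import Data.List.Relation.Unary.Sorted.TotalOrder.Properties using (Sorted⇒AllPairs)
open import Data.Nat
open import Data.Nat.Properties
open import Data.List.Sort ≤-decTotalOrder using (sort-↭; sort-↗)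
open import Data.Product using (Σ; _×_; _,_; proj₁; proj₂)
open import Data.Sum using (_⊎_; inj₁; inj₂)
open import Function using (_∘_)
open import Relation.Binary using (tri<; tri≈; tri>)
open import Relation.Binary.Bundles using (DecTotalOrder)
open import Relation.Binary.PropositionalEquality
open import Data.List.Relation.Binary.Permutation.Setoid.Properties (setoid ℕ) using (Unique-resp-↭)
open import Relation.Nullary using (¬_; yes; no; contradiction)
open import Relation.Nullary.Decidable using (dec-true; dec-false)
open ≡-Reasoning

MapsInto : ℕ → ℕ → (ℕ → ℕ) → Set
MapsInto a b f = ∀ x → 1 ≤ x → x ≤ a → 1 ≤ f x × f x ≤ b

InjectiveOn : ℕ → (ℕ → ℕ) → Set
InjectiveOn a f = ∀ x y → 1 ≤ x → x ≤ a → 1 ≤ y → y ≤ a → f x ≡ f y → x ≡ y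

Preimage : (ℕ → ℕ) → ℕ → ℕ → ℕ → Set
Preimage f a v x = 1 ≤ x × x ≤ a × f x ≡ v

Omits : (ℕ → ℕ) → ℕ → ℕ → Set
Omits f a v = ∀ x → 1 ≤ x → x ≤ a → f x ≢ v

invSearch-spec : ∀ f a v →
  (invSearch f a v ≡ 0 × Omits f a v) ⊎ Preimage f a v (invSearch f a v)
invSearch-spec f zero v = inj₁ (refl , λ x 1≤x x≤0 _ → contradiction (≤-trans 1≤x x≤0) λ ())
invSearch-spec f (suc a) v with f (suc a) ≟ v
... | yes hit rewrite dec-true (f (suc a) ≟ v) hit = inj₂ (s≤s z≤n , ≤-refl , hit)
... | no miss rewrite dec-false (f (suc a) ≟ v) miss with invSearch-spec f a v
...   | inj₂ (1≤x , x≤a , fx≡v) = inj₂ (1≤x , m≤n⇒m≤1+n x≤a , fx≡v)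
...   | inj₁ (none , omits) = inj₁ (none , omits′)
  where
  omits′ : Omits f (suc a) v
  omits′ x 1≤x x≤1+a with m≤n⇒m<n∨m≡n x≤1+a
  ... | inj₁ x<1+a = omits x 1≤x (s≤s⁻¹ x<1+a)
  ... | inj₂ refl = miss

preimage⇒invSearch-preimage : ∀ {f a v x} → Preimage f a v x → Preimage f a v (invSearch f a v)
preimage⇒invSearch-preimage {f} {a} {v} (1≤x , x≤a , fx≡v) with invSearch-spec f a v
... | inj₁ (_ , omits) = contradiction fx≡v (omits _ 1≤x x≤a)
... | inj₂ found = found

module OnFin {a b f} (maps : MapsInto a b f) (inj : InjectiveOn a f) where

  toFin : Fin a → Fin b
  toFin i = fromℕ< (pred-< (proj₁ (maps _ (s≤s z≤n) (toℕ<n i))) (proj₂ (maps _ (s≤s z≤n) (toℕ<n i))))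
    where
    pred-< : ∀ {x} → 1 ≤ x → x ≤ b → x ∸ 1 < b
    pred-< (s≤s z≤n) x≤b = x≤b

  suc-toℕ-toFin : ∀ i → suc (toℕ (toFin i)) ≡ f (suc (toℕ i))
  suc-toℕ-toFin i = trans (cong suc (toℕ-fromℕ< _)) (m+[n∸m]≡n (proj₁ (maps _ (s≤s z≤n) (toℕ<n i))))

  toFin-injective : ∀ {i j} → toFin i ≡ toFin j → i ≡ j
  toFin-injective {i} {j} eq = toℕ-injective (suc-injective
    (inj _ _ (s≤s z≤n) (toℕ<n i) (s≤s z≤n) (toℕ<n j)
      (trans (sym (suc-toℕ-toFin i)) (trans (cong (λ k → suc (toℕ k)) eq) (suc-toℕ-toFin j)))))

injectiveOn⇒≤ : ∀ {a b f} → MapsInto a b f → InjectiveOn a f → a ≤ b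
injectiveOn⇒≤ maps inj = injective⇒≤ (OnFin.toFin-injective maps inj)

injectiveOn-omitting⇒< : ∀ {a b f y} → MapsInto a b f → InjectiveOn a f →
  1 ≤ y → y ≤ b → Omits f a y → a < b
injectiveOn-omitting⇒< {b = suc b} {y = suc y} maps inj _ y≤b omits =
  s≤s (injective⇒≤ (λ {i} {j} eq → toFin-injective (punchOut-injective (y≢ i) (y≢ j) eq)))
  where
  open OnFin maps inj
  y≢ : ∀ i → fromℕ< y≤b ≢ toFin i
  y≢ i eq = omits _ (s≤s z≤n) (toℕ<n i)
    (trans (sym (suc-toℕ-toFin i)) (trans (cong (λ k → suc (toℕ k)) (sym eq)) (cong suc (toℕ-fromℕ< y≤b))))

invSearch-preimage : ∀ {a f} → MapsInto a a f → InjectiveOn a f →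
  ∀ y → 1 ≤ y → y ≤ a → Preimage f a y (invSearch f a y)
invSearch-preimage {a} {f} maps inj y 1≤y y≤a with invSearch-spec f a y
... | inj₂ found = found
... | inj₁ (_ , omits) = contradiction (injectiveOn-omitting⇒< maps inj 1≤y y≤a omits) (<-irrefl refl)

omitted-or-covered : ∀ f a b →
  (Σ ℕ λ y → 1 ≤ y × y ≤ b × Omits f a y)
  ⊎ (∀ y → 1 ≤ y → y ≤ b → Preimage f a y (invSearch f a y))
omitted-or-covered f a zero = inj₂ λ y 1≤y y≤0 → contradiction (≤-trans 1≤y y≤0) λ ()
omitted-or-covered f a (suc b) with omitted-or-covered f a b | invSearch-spec f a (suc b)
... | inj₁ (y , 1≤y , y≤b , omits) | _ = inj₁ (y , 1≤y , m≤n⇒m≤1+n y≤b , omits)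
... | inj₂ _ | inj₁ (_ , omits) = inj₁ (suc b , s≤s z≤n , ≤-refl , omits)
... | inj₂ covered | inj₂ found = inj₂ covered′
  where
  covered′ : ∀ y → 1 ≤ y → y ≤ suc b → Preimage f a y (invSearch f a y)
  covered′ y 1≤y y≤1+b with m≤n⇒m<n∨m≡n y≤1+b
  ... | inj₁ y<1+b = covered y 1≤y (s≤s⁻¹ y<1+b)
  ... | inj₂ refl = found

<⇒omitted : ∀ f {a b} → a < b → Σ ℕ λ y → 1 ≤ y × y ≤ b × Omits f a y
<⇒omitted f {a} {b} a<b with omitted-or-covered f a b
... | inj₁ omitted = omitted
... | inj₂ covered = contradiction (injectiveOn⇒≤ search-maps search-inj) (<⇒≱ a<b)
  where
  search-maps : MapsInto b a (invSearch f a)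
  search-maps y 1≤y y≤b = proj₁ (covered y 1≤y y≤b) , proj₁ (proj₂ (covered y 1≤y y≤b))
  search-inj : InjectiveOn b (invSearch f a)
  search-inj y y′ 1≤y y≤b 1≤y′ y′≤b eq =
    trans (sym (proj₂ (proj₂ (covered y 1≤y y≤b))))
          (trans (cong f eq) (proj₂ (proj₂ (covered y′ 1≤y′ y′≤b))))

MapsInto-∘ : ∀ {a b c f g} → MapsInto a b f → MapsInto b c g → MapsInto a c (λ x → g (f x))
MapsInto-∘ f-maps g-maps x 1≤x x≤a = g-maps _ (proj₁ (f-maps x 1≤x x≤a)) (proj₂ (f-maps x 1≤x x≤a))

InjectiveOn-∘ : ∀ {a b f g} → MapsInto a b f → InjectiveOn a f → InjectiveOn b g →
  InjectiveOn a (λ x → g (f x))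
InjectiveOn-∘ f-maps f-inj g-inj x y 1≤x x≤a 1≤y y≤a eq = f-inj x y 1≤x x≤a 1≤y y≤a
  (g-inj _ _ (proj₁ (f-maps x 1≤x x≤a)) (proj₂ (f-maps x 1≤x x≤a))
             (proj₁ (f-maps y 1≤y y≤a)) (proj₂ (f-maps y 1≤y y≤a)) eq)

IncreasingOn : ℕ → (ℕ → ℕ) → Set
IncreasingOn b f = ∀ x → 1 ≤ x → x < b → f x < f (suc x)

IncreasingOn⇒< : ∀ {b f} → IncreasingOn b f → ∀ {x y} → 1 ≤ x → x < y → y ≤ b → f x < f y
IncreasingOn⇒< steps {x} {suc y} 1≤x x<1+y 1+y≤b with m≤n⇒m<n∨m≡n (s≤s⁻¹ x<1+y)
... | inj₁ x<y =
  <-trans (IncreasingOn⇒< steps 1≤x x<y (<⇒≤ 1+y≤b)) (steps y (≤-trans 1≤x (<⇒≤ x<y)) 1+y≤b)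
... | inj₂ refl = steps x 1≤x 1+y≤b

IncreasingOn⇒≤ : ∀ {b f} → IncreasingOn b f → ∀ {x y} → 1 ≤ x → x ≤ y → y ≤ b → f x ≤ f y
IncreasingOn⇒≤ steps 1≤x x≤y y≤b with m≤n⇒m<n∨m≡n x≤y
... | inj₁ x<y = <⇒≤ (IncreasingOn⇒< steps 1≤x x<y y≤b)
... | inj₂ refl = ≤-refl

IncreasingOn⇒injectiveOn : ∀ {b f} → IncreasingOn b f → InjectiveOn b f
IncreasingOn⇒injectiveOn steps x y 1≤x x≤b 1≤y y≤b eq with <-cmp x y
... | tri< x<y _ _ = contradiction eq (<⇒≢ (IncreasingOn⇒< steps 1≤x x<y y≤b))
... | tri≈ _ x≡y _ = x≡y
... | tri> _ _ y<x = contradiction (sym eq) (<⇒≢ (IncreasingOn⇒< steps 1≤y y<x x≤b))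

at-All : ∀ {Q : ℕ × ℕ → Set} {I} → All Q I → ∀ {x} → 1 ≤ x → x ≤ length I → Q (at I x)
at-All (Qe ∷ _) {suc zero} _ _ = Qe
at-All (_ ∷ Qs) {suc (suc x)} _ (s≤s x<k) = at-All Qs (s≤s z≤n) x<k

∈⇒at : ∀ {e I} → e ∈ I → Σ ℕ λ x → 1 ≤ x × x ≤ length I × at I x ≡ e
∈⇒at (here refl) = 1 , ≤-refl , s≤s z≤n , refl
∈⇒at {I = _ ∷ I} (there e∈I) with ∈⇒at e∈I
... | suc x , _ , x<k , eq = suc (suc x) , s≤s z≤n , s≤s x<k , eq

AllPairs⇒at : ∀ {R : ℕ × ℕ → ℕ × ℕ → Set} {I} → AllPairs R I →
  ∀ {x y} → 1 ≤ x → x < y → y ≤ length I → R (at I x) (at I y)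
AllPairs⇒at _ {suc zero} {suc zero} _ (s≤s ()) _
AllPairs⇒at (Rs ∷ _) {suc zero} {suc (suc y)} _ _ (s≤s y<k) = at-All Rs (s≤s z≤n) y<k
AllPairs⇒at (_ ∷ Rss) {suc (suc x)} {suc (suc y)} _ (s≤s x<y) (s≤s y<k) = AllPairs⇒at Rss (s≤s z≤n) x<y y<k

pOf-inner : ∀ n I {x} → x ≤ length I → pOf n I x ≡ proj₁ (at I x)
pOf-inner n I {x} x≤k
  rewrite dec-false (x ≟ suc (length I)) (λ x≡ → 1+n≰n (subst (_≤ length I) x≡ x≤k)) = refl

pOf-end : ∀ n I → pOf n I (suc (length I)) ≡ suc n
pOf-end n I rewrite dec-true (suc (length I) ≟ suc (length I)) refl = refl

suffix-cons : ∀ T n x → x ≤ n → suffix T n x ≡ T x ∷ suffix T n (suc x)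
suffix-cons T n x x≤n = begin
  map T (applyUpTo (x +_) (suc n ∸ x))
    ≡⟨ cong (λ l → map T (applyUpTo (x +_) l)) (+-∸-assoc 1 x≤n) ⟩
  T (x + 0) ∷ map T (applyUpTo (λ m → x + suc m) (n ∸ x))
    ≡⟨ cong₂ _∷_ (cong T (+-identityʳ x)) (cong (map T) shift) ⟩
  T x ∷ suffix T n (suc x) ∎
  where
  shift : applyUpTo (λ m → x + suc m) (n ∸ x) ≡ applyUpTo (suc x +_) (n ∸ x)
  shift = begin
    applyUpTo (λ m → x + suc m) (n ∸ x)    ≡⟨ map-upTo _ (n ∸ x) ⟨
    map (λ m → x + suc m) (upTo (n ∸ x))   ≡⟨ map-cong (+-suc x) (upTo (n ∸ x)) ⟩
    map (suc x +_) (upTo (n ∸ x))          ≡⟨ map-upTo _ (n ∸ x) ⟩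
    applyUpTo (suc x +_) (n ∸ x)           ∎

suffix-end : ∀ T n → suffix T n (suc n) ≡ []
suffix-end T n = cong (λ l → map T (applyUpTo (suc n +_) l)) (n∸n≡0 n)

<ˢ-trans : ∀ {xs ys zs} → xs <ˢ ys → ys <ˢ zs → xs <ˢ zs
<ˢ-trans = <-transitive isEquivalence <-resp₂-≡ <-trans

<ˢ-irrefl : ∀ {xs} → ¬ xs <ˢ xs
<ˢ-irrefl xs<xs = <-asymmetric sym <-resp₂-≡ <-asym xs<xs xs<xs

<ˢ-between-cons : ∀ {c d xs ys zs} → (c ∷ xs) <ˢ (d ∷ ys) → (d ∷ ys) <ˢ (c ∷ zs) →
  xs <ˢ ys × ys <ˢ zs
<ˢ-between-cons (Lex.this c<d) (Lex.this d<c) = contradiction d<c (<-asym c<d)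
<ˢ-between-cons (Lex.this c<d) (Lex.next refl _) = contradiction c<d (<-irrefl refl)
<ˢ-between-cons (Lex.next refl _) (Lex.this d<c) = contradiction d<c (<-irrefl refl)
<ˢ-between-cons (Lex.next refl xs<ys) (Lex.next _ ys<zs) = xs<ys , ys<zs

module IntervalSequence
  (n : ℕ) (I : List (ℕ × ℕ)) (φ : ℕ → ℕ)
  (φ-maps : MapsInto n n φ) (φ-injective : InjectiveOn n φ)
  (nonempty : 1 ≤ length I)
  (p-first : pOf n I 1 ≡ 1)
  (p-increasing : IncreasingOn (suc (length I)) (pOf n I))
  (q≡φ∘p : ∀ x → 1 ≤ x → x ≤ length I → qOf I x ≡ φ (pOf n I x))
  (φ-step : ∀ j → 2 ≤ j → j ≤ n → Omits (pOf n I) (length I) j → φ j ≡ suc (φ (j ∸ 1)))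
  where

  private
    k : ℕ
    k = length I
    p q : ℕ → ℕ
    p = pOf n I
    q = qOf I

  p-mono : ∀ {x y} → 1 ≤ x → x ≤ y → y ≤ suc k → p x ≤ p y
  p-mono = IncreasingOn⇒≤ p-increasing

  p-positive : ∀ {x} → 1 ≤ x → x ≤ suc k → 1 ≤ p x
  p-positive 1≤x x≤1+k = subst (_≤ p _) p-first (p-mono ≤-refl 1≤x x≤1+k)

  p≤n : ∀ {x} → 1 ≤ x → x ≤ k → p x ≤ n
  p≤n 1≤x x≤k = s≤s⁻¹ (subst (p _ <_) (pOf-end n I) (IncreasingOn⇒< p-increasing 1≤x (s≤s x≤k) ≤-refl))

  p-next≤1+n : ∀ {x} → x ≤ k → p (suc x) ≤ suc n
  p-next≤1+n x≤k = subst (p _ ≤_) (pOf-end n I) (p-mono (s≤s z≤n) (s≤s x≤k) ≤-refl)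

  1≤n : 1 ≤ n
  1≤n = ≤-trans (p-positive ≤-refl (s≤s z≤n)) (p≤n ≤-refl nonempty)

  block-index-unique : ∀ {x y i} → 1 ≤ x → x ≤ k → 1 ≤ y → y ≤ k →
    p x ≤ i → i < p (suc x) → p y ≤ i → i < p (suc y) → x ≡ y
  block-index-unique {x} {y} 1≤x x≤k 1≤y y≤k px≤i i<px′ py≤i i<py′ with <-cmp x y
  ... | tri< x<y _ _ = contradiction (≤-trans (p-mono (s≤s z≤n) x<y (m≤n⇒m≤1+n y≤k)) py≤i) (<⇒≱ i<px′)
  ... | tri≈ _ x≡y _ = x≡y
  ... | tri> _ _ y<x = contradiction (≤-trans (p-mono (s≤s z≤n) y<x (m≤n⇒m≤1+n x≤k)) px≤i) (<⇒≱ i<py′)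

  no-boundary-inside-block : ∀ {x j} → 1 ≤ x → x ≤ k → p x < j → j < p (suc x) → Omits p k j
  no-boundary-inside-block {x} 1≤x x≤k px<j j<px′ y 1≤y y≤k py≡j = <-irrefl (trans (cong p x≡y) py≡j) px<j
    where
    x≡y : x ≡ y
    x≡y = block-index-unique 1≤x x≤k 1≤y y≤k (<⇒≤ px<j) j<px′ (≤-reflexive py≡j)
            (subst (_< p (suc _)) py≡j (p-increasing _ 1≤y (s≤s y≤k)))

  φ-on-block : ∀ {x} d → 1 ≤ x → x ≤ k → p x + d < p (suc x) → φ (p x + d) ≡ q x + d
  φ-on-block {x} zero 1≤x x≤k _ = begin
    φ (p x + 0)  ≡⟨ cong φ (+-identityʳ (p x)) ⟩
    φ (p x)      ≡⟨ q≡φ∘p x 1≤x x≤k ⟨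
    q x          ≡⟨ +-identityʳ (q x) ⟨
    q x + 0      ∎
  φ-on-block {x} (suc d) 1≤x x≤k in-block = begin
    φ (p x + suc d)      ≡⟨ cong φ (+-suc (p x) d) ⟩
    φ (suc (p x + d))    ≡⟨ φ-step _ 2≤j j≤n (no-boundary-inside-block 1≤x x≤k (s≤s (m≤m+n (p x) d)) j<px′) ⟩
    suc (φ (p x + d))    ≡⟨ cong suc (φ-on-block d 1≤x x≤k (<-trans (n<1+n _) j<px′)) ⟩
    suc (q x + d)        ≡⟨ +-suc (q x) d ⟨
    q x + suc d          ∎
    where
    j<px′ : suc (p x + d) < p (suc x)
    j<px′ = subst (_< p (suc x)) (+-suc (p x) d) in-block
    2≤j : 2 ≤ suc (p x + d)
    2≤j = s≤s (≤-trans (p-positive 1≤x (m≤n⇒m≤1+n x≤k)) (m≤m+n (p x) d))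
    j≤n : suc (p x + d) ≤ n
    j≤n = s≤s⁻¹ (≤-trans j<px′ (p-next≤1+n x≤k))

  represents : Represents n I φ
  represents i x _ _ 1≤x x≤k px≤i i<px′ = begin
    φ i                   ≡⟨ cong φ (m+[n∸m]≡n px≤i) ⟨
    φ (p x + (i ∸ p x))   ≡⟨ φ-on-block _ 1≤x x≤k (subst (_< p (suc x)) (sym (m+[n∸m]≡n px≤i)) i<px′) ⟩
    q x + (i ∸ p x)       ∎

  position-in-range : ∀ {x i} → 1 ≤ x → x ≤ k → p x ≤ i → i < p (suc x) → 1 ≤ i × i ≤ n
  position-in-range 1≤x x≤k px≤i i<px′ =
    ≤-trans (p-positive 1≤x (m≤n⇒m≤1+n x≤k)) px≤i , s≤s⁻¹ (≤-trans i<px′ (p-next≤1+n x≤k))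

  len : ℕ → ℕ
  len x = p (suc x) ∸ p x

  next : ℕ → ℕ
  next x = q x + len x

  module Block {x} (1≤x : 1 ≤ x) (x≤k : x ≤ k) where

    p<p-next : p x < p (suc x)
    p<p-next = p-increasing x 1≤x (s≤s x≤k)

    p+len : p x + len x ≡ p (suc x)
    p+len = m+[n∸m]≡n (<⇒≤ p<p-next)

    1≤len : 1 ≤ len x
    1≤len = m<n⇒0<n∸m p<p-next

    q<next : q x < next x
    q<next = m<m+n (q x) 1≤len

    offset-in-block : ∀ {e} → e < len x → p x + e < p (suc x)
    offset-in-block e<len = subst (p x + _ <_) p+len (+-monoʳ-< (p x) e<len)

    value-offset<len : ∀ {v} → q x ≤ v → v < next x → v ∸ q x < len x
    value-offset<len {v} qx≤v v<next = subst (v ∸ q x <_) (m+n∸m≡n (q x) (len x)) (∸-monoˡ-< v<next qx≤v)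

    last≡ : p (suc x) ∸ 1 ≡ p x + (len x ∸ 1)
    last≡ = trans (cong (_∸ 1) (sym p+len)) (+-∸-assoc (p x) 1≤len)

    last<p-next : p (suc x) ∸ 1 < p (suc x)
    last<p-next = subst (_< p (suc x)) (sym last≡) (offset-in-block (∸-monoˡ-< ≤-refl 1≤len))

    last-in-range : 1 ≤ p (suc x) ∸ 1 × p (suc x) ∸ 1 ≤ n
    last-in-range = position-in-range 1≤x x≤k (subst (p x ≤_) (sym last≡) (m≤m+n (p x) _)) last<p-next

    next≡suc-φ-last : next x ≡ suc (φ (p (suc x) ∸ 1))
    next≡suc-φ-last = begin
      q x + len x                    ≡⟨ cong (q x +_) (m+[n∸m]≡n 1≤len) ⟨
      q x + suc (len x ∸ 1)          ≡⟨ +-suc (q x) _ ⟩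
      suc (q x + (len x ∸ 1))        ≡⟨ cong suc (φ-on-block _ 1≤x x≤k (subst (_< p (suc x)) last≡ last<p-next)) ⟨
      suc (φ (p x + (len x ∸ 1)))    ≡⟨ cong (λ i → suc (φ i)) last≡ ⟨
      suc (φ (p (suc x) ∸ 1))        ∎

  q-in-range : ∀ {x} → 1 ≤ x → x ≤ k → 1 ≤ q x × q x ≤ n
  q-in-range {x} 1≤x x≤k = subst (λ v → 1 ≤ v × v ≤ n) (sym (q≡φ∘p x 1≤x x≤k))
    (φ-maps (p x) (p-positive 1≤x (m≤n⇒m≤1+n x≤k)) (p≤n 1≤x x≤k))

  block-start-unique : ∀ {x y} → 1 ≤ x → x ≤ k → 1 ≤ y → y ≤ k →
    q y ≤ q x → q x < next y → x ≡ y
  block-start-unique {x} {y} 1≤x x≤k 1≤y y≤k qy≤qx qx<next =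
    block-index-unique 1≤x x≤k 1≤y y≤k ≤-refl (p<p-next 1≤x x≤k)
      (subst (p y ≤_) i≡px (m≤m+n (p y) _)) (subst (_< p (suc y)) i≡px i<py′)
    where
    open Block
    i : ℕ
    i = p y + (q x ∸ q y)
    i<py′ : i < p (suc y)
    i<py′ = offset-in-block 1≤y y≤k (value-offset<len 1≤y y≤k qy≤qx qx<next)
    φi≡φpx : φ i ≡ φ (p x)
    φi≡φpx = begin
      φ i                 ≡⟨ φ-on-block _ 1≤y y≤k i<py′ ⟩
      q y + (q x ∸ q y)   ≡⟨ m+[n∸m]≡n qy≤qx ⟩
      q x                 ≡⟨ q≡φ∘p x 1≤x x≤k ⟩
      φ (p x)             ∎
    i≡px : i ≡ p x
    i≡px with position-in-range 1≤y y≤k (m≤m+n (p y) _) i<py′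
    ... | 1≤i , i≤n = φ-injective _ _ 1≤i i≤n (p-positive 1≤x (m≤n⇒m≤1+n x≤k)) (p≤n 1≤x x≤k) φi≡φpx

  ValueBoundary : ℕ → Set
  ValueBoundary v = v ≡ 1 ⊎ Σ ℕ λ y → 1 ≤ y × y ≤ k × next y ≡ v

  -- Write v = φ j.  If j is no p x, then v = φ (j - 1) + 1: this excludes v = 1, and
  -- v = next y makes j - 1 the last position of block y, i.e. j = p (y + 1).
  value-starts-block : ∀ v → 1 ≤ v → v ≤ n → ValueBoundary v → Σ ℕ (Preimage q k v)
  value-starts-block v 1≤v v≤n boundary
    with invSearch φ n v | invSearch-preimage φ-maps φ-injective v 1≤v v≤n
  ... | j | 1≤j , j≤n , φj≡v with invSearch-spec p k j
  ...   | inj₂ (1≤x , x≤k , px≡j) =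
    _ , 1≤x , x≤k , trans (q≡φ∘p _ 1≤x x≤k) (trans (cong φ px≡j) φj≡v)
  ...   | inj₁ (_ , omits) = contradiction boundary impossible
    where
    2≤j : 2 ≤ j
    2≤j = ≤∧≢⇒< 1≤j (λ 1≡j → omits 1 ≤-refl nonempty (trans p-first 1≡j))
    v≡suc : v ≡ suc (φ (j ∸ 1))
    v≡suc = trans (sym φj≡v) (φ-step j 2≤j j≤n omits)
    j∸1-in-range : 1 ≤ j ∸ 1 × j ∸ 1 ≤ n
    j∸1-in-range = ∸-monoˡ-≤ 1 2≤j , ≤-trans (m∸n≤m j 1) j≤n
    omits-end : Omits p (suc k) j
    omits-end z 1≤z z≤1+k with m≤n⇒m<n∨m≡n z≤1+k
    ... | inj₁ z<1+k = omits z 1≤z (s≤s⁻¹ z<1+k)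
    ... | inj₂ refl = λ p-end≡j → 1+n≰n (subst (_≤ n) (trans (sym p-end≡j) (pOf-end n I)) j≤n)
    impossible : ¬ ValueBoundary v
    impossible (inj₁ v≡1) = contradiction (suc-injective (trans (sym v≡suc) v≡1))
      (≢-sym (<⇒≢ (proj₁ (φ-maps _ (proj₁ j∸1-in-range) (proj₂ j∸1-in-range)))))
    impossible (inj₂ (y , 1≤y , y≤k , next≡v)) = omits-end (suc y) (s≤s z≤n) (s≤s y≤k) py′≡j
      where
      last : 1 ≤ p (suc y) ∸ 1 × p (suc y) ∸ 1 ≤ n
      last = Block.last-in-range 1≤y y≤k
      py′≡j : p (suc y) ≡ j
      py′≡j = ∸-cancelʳ-≡ (p-positive (s≤s z≤n) (s≤s y≤k)) 1≤j
        (φ-injective _ _ (proj₁ last) (proj₂ last) (proj₁ j∸1-in-range) (proj₂ j∸1-in-range)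
          (suc-injective (trans (sym (Block.next≡suc-φ-last 1≤y y≤k)) (trans next≡v v≡suc))))

  -- blockStart i is the first value of the (i+1)-st block in value order, π i the index of the i-th.
  blockStart : ℕ → ℕ
  blockStart zero = 1
  blockStart (suc i) = next (invSearch q k (blockStart i))

  π : ℕ → ℕ
  π i = invSearch q k (blockStart (pred i))

  Placed : ℕ → Set
  Placed m = 1 ≤ π m × π m ≤ k

  PlacedUpTo : ℕ → Set
  PlacedUpTo i = ∀ m → 1 ≤ m → m ≤ i → Placed m

  q∘π≡blockStart : ∀ m → Placed m → q (π m) ≡ blockStart (pred m)
  q∘π≡blockStart m (1≤πm , _) with invSearch-spec q k (blockStart (pred m))
  ... | inj₁ (πm≡0 , _) = contradiction (subst (1 ≤_) πm≡0 1≤πm) λ ()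
  ... | inj₂ (_ , _ , found) = found

  q∘π-increasing : ∀ {i} → PlacedUpTo i → IncreasingOn i (λ m → q (π m))
  q∘π-increasing placed (suc m) _ 1+m<i with placed (suc m) (s≤s z≤n) (<⇒≤ 1+m<i)
  ... | 1≤πm , πm≤k =
    subst (q (π (suc m)) <_) (sym (q∘π≡blockStart (suc (suc m)) (placed _ (s≤s z≤n) 1+m<i)))
      (Block.q<next 1≤πm πm≤k)

  Covered : ℕ → ℕ → Set
  Covered i v = Σ ℕ λ m → 1 ≤ m × m ≤ i × q (π m) ≤ v × v < next (π m)

  Covered-suc : ∀ {i v} → Covered i v → Covered (suc i) v
  Covered-suc (m , 1≤m , m≤i , lower , upper) = m , 1≤m , m≤n⇒m≤1+n m≤i , lower , upper

  covered : ∀ i → PlacedUpTo (suc i) → ∀ v → 1 ≤ v → v < next (π (suc i)) → Covered (suc i) v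
  covered zero placed v 1≤v v<next =
    1 , ≤-refl , ≤-refl , subst (_≤ v) (sym (q∘π≡blockStart 1 (placed 1 ≤-refl ≤-refl))) 1≤v , v<next
  covered (suc i) placed v 1≤v v<next with v <? next (π (suc i))
  ... | yes v<next′ =
    Covered-suc (covered i (λ m 1≤m m≤1+i → placed m 1≤m (m≤n⇒m≤1+n m≤1+i)) v 1≤v v<next′)
  ... | no v≮next′ =
    suc (suc i) , s≤s z≤n , ≤-refl ,
    subst (_≤ v) (sym (q∘π≡blockStart (suc (suc i)) (placed _ (s≤s z≤n) ≤-refl))) (≮⇒≥ v≮next′) ,
    v<next

  -- If the first i blocks in value order already reached n, a block left out of them would
  -- have to start inside one of them.
  next<1+n : ∀ i → suc i < k → PlacedUpTo (suc i) → next (π (suc i)) < suc n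
  next<1+n i i<k placed with <⇒omitted π i<k | placed (suc i) (s≤s z≤n) ≤-refl
  ... | x , 1≤x , x≤k , omitted | 1≤πi , πi≤k = ≤∧≢⇒< next≤1+n next≢1+n
    where
    next≤1+n : next (π (suc i)) ≤ suc n
    next≤1+n = subst (_≤ suc n) (sym (Block.next≡suc-φ-last 1≤πi πi≤k))
      (s≤s (proj₂ (φ-maps _ (proj₁ (Block.last-in-range 1≤πi πi≤k))
                            (proj₂ (Block.last-in-range 1≤πi πi≤k)))))
    next≢1+n : next (π (suc i)) ≢ suc n
    next≢1+n next≡1+n with covered i placed (q x) (proj₁ (q-in-range 1≤x x≤k))
                             (subst (q x <_) (sym next≡1+n) (s≤s (proj₂ (q-in-range 1≤x x≤k))))
    ... | m , 1≤m , m≤i , lower , upper =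
      omitted m 1≤m m≤i (sym (block-start-unique 1≤x x≤k
        (proj₁ (placed m 1≤m m≤i)) (proj₂ (placed m 1≤m m≤i)) lower upper))

  placed-if-starts-block : ∀ i → Σ ℕ (Preimage q k (blockStart i)) → Placed (suc i)
  placed-if-starts-block i (_ , preimage) with preimage⇒invSearch-preimage preimage
  ... | 1≤x , x≤k , _ = 1≤x , x≤k

  placed-next : ∀ i → i < k → PlacedUpTo i → Placed (suc i)
  placed-next zero _ _ = placed-if-starts-block 0 (value-starts-block 1 ≤-refl 1≤n (inj₁ refl))
  placed-next (suc i) 1+i<k placed = placed-if-starts-block (suc i)
    (value-starts-block (next (π (suc i))) (≤-<-trans z≤n (Block.q<next 1≤πi πi≤k))
      (s≤s⁻¹ (next<1+n i 1+i<k placed)) (inj₂ (π (suc i) , 1≤πi , πi≤k , refl)))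
    where
    1≤πi : 1 ≤ π (suc i)
    1≤πi = proj₁ (placed (suc i) (s≤s z≤n) ≤-refl)
    πi≤k : π (suc i) ≤ k
    πi≤k = proj₂ (placed (suc i) (s≤s z≤n) ≤-refl)

  placed : ∀ i → i ≤ k → PlacedUpTo i
  placed zero _ m 1≤m m≤0 = contradiction (≤-trans 1≤m m≤0) λ ()
  placed (suc i) 1+i≤k m 1≤m m≤1+i with m≤n⇒m<n∨m≡n m≤1+i
  ... | inj₁ m<1+i = placed i (<⇒≤ 1+i≤k) m 1≤m (s≤s⁻¹ m<1+i)
  ... | inj₂ refl = placed-next i 1+i≤k (placed i (<⇒≤ 1+i≤k))

  π-maps : MapsInto k k π
  π-maps = placed k ≤-refl

  π-injective : InjectiveOn k π
  π-injective x y 1≤x x≤k 1≤y y≤k πx≡πy =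
    IncreasingOn⇒injectiveOn (q∘π-increasing π-maps) x y 1≤x x≤k 1≤y y≤k (cong q πx≡πy)

  isDisjoint : IsDisjointIntervalSequence n I
  isDisjoint =
    π , (π-maps , π-injective , λ x 1≤x x≤k → _ , invSearch-preimage π-maps π-injective x 1≤x x≤k) ,
    (p-first , (λ x 1≤x x<k → p-increasing x 1≤x (m<n⇒m<1+n x<k)) , p≤n nonempty ≤-refl) ,
    q∘π≡blockStart 1 (π-maps 1 ≤-refl nonempty) ,
    follows
    where
    follows : ∀ i → 2 ≤ i → i ≤ k → q (π i) ≡ next (π (i ∸ 1))
    follows (suc zero) (s≤s ()) _
    follows (suc (suc i)) _ i≤k = q∘π≡blockStart (suc (suc i)) (π-maps _ (s≤s z≤n) i≤k)

cyclicPred : ℕ → ℕ → ℕ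
cyclicPred n k = if k ≡ᵇ 1 then n else k ∸ 1

cyclicPred-maps : ∀ {n} → 1 ≤ n → MapsInto n n (cyclicPred n)
cyclicPred-maps 1≤n (suc zero) _ _ = 1≤n , ≤-refl
cyclicPred-maps 1≤n (suc (suc k)) _ 2+k≤n = s≤s z≤n , <⇒≤ 2+k≤n

cyclicPred-injective : ∀ {n} → InjectiveOn n (cyclicPred n)
cyclicPred-injective (suc zero) (suc zero) _ _ _ _ _ = refl
cyclicPred-injective (suc zero) (suc (suc y)) _ _ _ 2+y≤n n≡1+y =
  contradiction (subst (2 + y ≤_) n≡1+y 2+y≤n) 1+n≰n
cyclicPred-injective (suc (suc x)) (suc zero) _ 2+x≤n _ _ 1+x≡n =
  contradiction (subst (2 + x ≤_) (sym 1+x≡n) 2+x≤n) 1+n≰n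
cyclicPred-injective (suc (suc x)) (suc (suc y)) _ _ _ _ eq = cong suc eq

cyclicPred-suc : ∀ {n b} → 1 ≤ b → cyclicPred n (suc b) ≡ b
cyclicPred-suc (s≤s z≤n) = refl

module SuffixArray (n : ℕ) (T SA : ℕ → ℕ) (text : IsText n T) (sa : IsSuffixArray n T SA) where

  S : ℕ → List ℕ
  S = suffix T n

  L : ℕ → ℕ
  L = BWT n T SA

  isa : ℕ → ℕ
  isa = invSearch SA n

  φ : ℕ → ℕ
  φ = phi n SA

  1≤n : 1 ≤ n
  1≤n = proj₁ text

  SA-maps : MapsInto n n SA
  SA-maps = proj₁ sa

  SA-injective : InjectiveOn n SA
  SA-injective = proj₁ (proj₂ sa)

  SA-sorted : ∀ {k k′} → 1 ≤ k → k < k′ → k′ ≤ n → S (SA k) <ˢ S (SA k′)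
  SA-sorted = proj₂ (proj₂ sa) _ _

  SA-order-reflecting : ∀ {k k′} → 1 ≤ k → k ≤ n → 1 ≤ k′ → k′ ≤ n →
    S (SA k) <ˢ S (SA k′) → k < k′
  SA-order-reflecting {k} {k′} 1≤k k≤n 1≤k′ k′≤n Sk<Sk′ with <-cmp k k′
  ... | tri< k<k′ _ _ = k<k′
  ... | tri≈ _ refl _ = contradiction Sk<Sk′ <ˢ-irrefl
  ... | tri> _ _ k′<k = contradiction (<ˢ-trans Sk<Sk′ (SA-sorted 1≤k′ k′<k k≤n)) <ˢ-irrefl

  isa-preimage : ∀ i → 1 ≤ i → i ≤ n → Preimage SA n i (isa i)
  isa-preimage = invSearch-preimage SA-maps SA-injective

  SA∘isa : ∀ {i} → 1 ≤ i → i ≤ n → SA (isa i) ≡ i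
  SA∘isa {i} 1≤i i≤n = proj₂ (proj₂ (isa-preimage i 1≤i i≤n))

  isa-maps : MapsInto n n isa
  isa-maps i 1≤i i≤n = proj₁ (isa-preimage i 1≤i i≤n) , proj₁ (proj₂ (isa-preimage i 1≤i i≤n))

  isa-injective : InjectiveOn n isa
  isa-injective i i′ 1≤i i≤n 1≤i′ i′≤n eq =
    trans (sym (SA∘isa 1≤i i≤n)) (trans (cong SA eq) (SA∘isa 1≤i′ i′≤n))

  isa-pred : ∀ {i} → 2 ≤ i → i ≤ n → Preimage SA n (i ∸ 1) (isa (i ∸ 1))
  isa-pred 2≤i i≤n = isa-preimage _ (∸-monoˡ-≤ 1 2≤i) (≤-trans (m∸n≤m _ 1) i≤n)

  φ≡SA∘cyclicPred∘isa : ∀ i → φ i ≡ SA (cyclicPred n (isa i))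
  φ≡SA∘cyclicPred∘isa i = sym (if-float SA (isa i ≡ᵇ 1))

  φ-at-rank : ∀ {i r} → isa i ≡ r → φ i ≡ SA (cyclicPred n r)
  φ-at-rank {i} isa-i≡r = trans (φ≡SA∘cyclicPred∘isa i) (cong (SA ∘ cyclicPred n) isa-i≡r)

  φ-maps : MapsInto n n φ
  φ-maps i 1≤i i≤n = subst (λ v → 1 ≤ v × v ≤ n) (sym (φ≡SA∘cyclicPred∘isa i))
    (MapsInto-∘ (MapsInto-∘ isa-maps (cyclicPred-maps 1≤n)) SA-maps i 1≤i i≤n)

  φ-injective : InjectiveOn n φ
  φ-injective i i′ 1≤i i≤n 1≤i′ i′≤n eq =
    InjectiveOn-∘ (MapsInto-∘ isa-maps (cyclicPred-maps 1≤n))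
      (InjectiveOn-∘ isa-maps isa-injective cyclicPred-injective) SA-injective
      i i′ 1≤i i≤n 1≤i′ i′≤n
      (trans (sym (φ≡SA∘cyclicPred∘isa i)) (trans eq (φ≡SA∘cyclicPred∘isa i′)))

  dollar-smallest : ∀ {i} → 2 ≤ i → i ≤ n → T n < T (i ∸ 1)
  dollar-smallest {suc zero} (s≤s ()) _
  dollar-smallest {suc (suc i)} _ 2+i≤n = proj₂ text (suc i) (s≤s z≤n) 2+i≤n

  L-at-start : ∀ {k} → SA k ≡ 1 → L k ≡ T n
  L-at-start {k} SAk≡1 = cong (λ i → if i ≡ᵇ 1 then T n else T (i ∸ 1)) SAk≡1

  L-elsewhere : ∀ {k} → 2 ≤ SA k → L k ≡ T (SA k ∸ 1)
  L-elsewhere {k} 2≤SAk rewrite dec-false (SA k ≟ 1) (>⇒≢ 2≤SAk) = refl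

  L≡T[n]⇒SA≡1 : ∀ {k} → 1 ≤ k → k ≤ n → L k ≡ T n → SA k ≡ 1
  L≡T[n]⇒SA≡1 {k} 1≤k k≤n Lk≡T[n] with SA k ≟ 1
  ... | yes SAk≡1 = SAk≡1
  ... | no SAk≢1 = contradiction (trans (sym Lk≡T[n]) (L-elsewhere 2≤SAk))
        (<⇒≢ (dollar-smallest 2≤SAk (proj₂ (SA-maps k 1≤k k≤n))))
    where
    2≤SAk : 2 ≤ SA k
    2≤SAk = ≤∧≢⇒< (proj₁ (SA-maps k 1≤k k≤n)) (≢-sym SAk≢1)

  same-letter⇒2≤SA : ∀ {k k′} → 1 ≤ k → k ≤ n → 1 ≤ k′ → k′ ≤ n →
    k ≢ k′ → L k ≡ L k′ → 2 ≤ SA k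
  same-letter⇒2≤SA {k} 1≤k k≤n 1≤k′ k′≤n k≢k′ Lk≡Lk′ with SA k ≟ 1
  ... | no SAk≢1 = ≤∧≢⇒< (proj₁ (SA-maps k 1≤k k≤n)) (≢-sym SAk≢1)
  ... | yes SAk≡1 = contradiction (SA-injective _ _ 1≤k k≤n 1≤k′ k′≤n
        (trans SAk≡1 (sym (L≡T[n]⇒SA≡1 1≤k′ k′≤n (trans (sym Lk≡Lk′) (L-at-start SAk≡1)))))) k≢k′

  suffix-pred : ∀ {i} → 2 ≤ i → i ≤ n → S (i ∸ 1) ≡ T (i ∸ 1) ∷ S i
  suffix-pred {suc zero} (s≤s ()) _
  suffix-pred {suc (suc i)} _ 2+i≤n = suffix-cons T n (suc i) (<⇒≤ 2+i≤n)

  no-suffix-between-neighbours : ∀ {k j} → 1 ≤ k → suc k ≤ n → 1 ≤ j → j ≤ suc n →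
    S (SA k) <ˢ S j → S j <ˢ S (SA (suc k)) → ⊥
  no-suffix-between-neighbours {k} {j} 1≤k 1+k≤n 1≤j j≤1+n lower upper with m≤n⇒m<n∨m≡n j≤1+n
  ... | inj₂ refl = xs≮[] (subst (S (SA k) <ˢ_) (suffix-end T n) lower)
  ... | inj₁ j<1+n = contradiction
        (SA-order-reflecting 1≤r r≤n (s≤s z≤n) 1+k≤n
          (subst (λ i → S i <ˢ S (SA (suc k))) (sym SAr≡j) upper))
        (≤⇒≯ (SA-order-reflecting 1≤k (<⇒≤ 1+k≤n) 1≤r r≤n
          (subst (λ i → S (SA k) <ˢ S i) (sym SAr≡j) lower)))
    where
    j≤n : j ≤ n
    j≤n = s≤s⁻¹ j<1+n
    1≤r : 1 ≤ isa j
    1≤r = proj₁ (isa-maps j 1≤j j≤n)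
    r≤n : isa j ≤ n
    r≤n = proj₂ (isa-maps j 1≤j j≤n)
    SAr≡j : SA (isa j) ≡ j
    SAr≡j = SA∘isa 1≤j j≤n

  -- Prepending the common letter keeps the two suffixes SA-adjacent: a suffix strictly
  -- between them would start with the same letter, and its tail would lie strictly
  -- between S(SA k) and S(SA (k+1)).
  LF-neighbours : ∀ {k} → 1 ≤ k → suc k ≤ n → L (suc k) ≡ L k →
    isa (SA (suc k) ∸ 1) ≡ suc (isa (SA k ∸ 1))
  LF-neighbours {k} 1≤k 1+k≤n same = ≤-antisym (≮⇒≥ nothing-between) b<a
    where
    k≤n : k ≤ n
    k≤n = <⇒≤ 1+k≤n
    i i′ : ℕ
    i = SA (suc k)
    i′ = SA k
    2≤i : 2 ≤ i
    2≤i = same-letter⇒2≤SA (s≤s z≤n) 1+k≤n 1≤k k≤n 1+n≢n same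
    2≤i′ : 2 ≤ i′
    2≤i′ = same-letter⇒2≤SA 1≤k k≤n (s≤s z≤n) 1+k≤n (≢-sym 1+n≢n) (sym same)
    i≤n : i ≤ n
    i≤n = proj₂ (SA-maps _ (s≤s z≤n) 1+k≤n)
    i′≤n : i′ ≤ n
    i′≤n = proj₂ (SA-maps _ 1≤k k≤n)
    a b : ℕ
    a = isa (i ∸ 1)
    b = isa (i′ ∸ 1)
    a-preimage : Preimage SA n (i ∸ 1) a
    a-preimage = isa-pred 2≤i i≤n
    b-preimage : Preimage SA n (i′ ∸ 1) b
    b-preimage = isa-pred 2≤i′ i′≤n
    Sa : S (SA a) ≡ T (i ∸ 1) ∷ S i
    Sa = trans (cong S (proj₂ (proj₂ a-preimage))) (suffix-pred 2≤i i≤n)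
    Sb : S (SA b) ≡ T (i ∸ 1) ∷ S i′
    Sb = trans (cong S (proj₂ (proj₂ b-preimage)))
               (trans (suffix-pred 2≤i′ i′≤n) (cong (_∷ S i′) letter≡))
      where
      letter≡ : T (i′ ∸ 1) ≡ T (i ∸ 1)
      letter≡ = trans (sym (L-elsewhere 2≤i′)) (trans (sym same) (L-elsewhere 2≤i))
    b<a : b < a
    b<a = SA-order-reflecting (proj₁ b-preimage) (proj₁ (proj₂ b-preimage))
                              (proj₁ a-preimage) (proj₁ (proj₂ a-preimage))
      (subst₂ _<ˢ_ (sym Sb) (sym Sa) (Lex.next refl (SA-sorted 1≤k ≤-refl 1+k≤n)))
    nothing-between : ¬ (suc b < a)
    nothing-between 1+b<a =
      no-suffix-between-neighbours 1≤k 1+k≤n (s≤s z≤n) (s≤s j≤n) (proj₁ tails) (proj₂ tails)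
      where
      1+b≤n : suc b ≤ n
      1+b≤n = ≤-trans (<⇒≤ 1+b<a) (proj₁ (proj₂ a-preimage))
      j : ℕ
      j = SA (suc b)
      j≤n : j ≤ n
      j≤n = proj₂ (SA-maps _ (s≤s z≤n) 1+b≤n)
      tails : S i′ <ˢ S (suc j) × S (suc j) <ˢ S i
      tails = <ˢ-between-cons
        (subst₂ _<ˢ_ Sb (suffix-cons T n j j≤n) (SA-sorted (proj₁ b-preimage) ≤-refl 1+b≤n))
        (subst₂ _<ˢ_ (suffix-cons T n j j≤n) Sa (SA-sorted (s≤s z≤n) 1+b<a (proj₁ (proj₂ a-preimage))))

  same-letter : ∀ {k} → isRunStart L (suc (suc k)) ≡ false → L (suc (suc k)) ≡ L (suc k)
  same-letter {k} not-start with L (suc (suc k)) ≟ L (suc k)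
  ... | yes same = same
  ... | no differ =
    contradiction (trans (sym (cong not (dec-false (L (suc (suc k)) ≟ L (suc k)) differ))) not-start) λ ()

  φ-step : ∀ j → 2 ≤ j → j ≤ n → isRunStart L (isa j) ≡ false → φ j ≡ suc (φ (j ∸ 1))
  φ-step j 2≤j j≤n not-start with isa j | isa-preimage j (≤-trans (s≤s z≤n) 2≤j) j≤n
  ... | suc zero | _ = contradiction not-start λ ()
  ... | suc (suc k) | _ , 2+k≤n , SA[2+k]≡j = begin
    SA (suc k)                        ≡⟨ m+[n∸m]≡n (≤-trans (s≤s z≤n) 2≤SA[1+k]) ⟨
    suc (SA (suc k) ∸ 1)              ≡⟨ cong suc (proj₂ (proj₂ b-preimage)) ⟨
    suc (SA b)                        ≡⟨ cong (λ r → suc (SA r)) (cyclicPred-suc (proj₁ b-preimage)) ⟨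
    suc (SA (cyclicPred n (suc b)))   ≡⟨ cong suc (φ-at-rank isa[j∸1]≡) ⟨
    suc (φ (j ∸ 1))                   ∎
    where
    same : L (suc (suc k)) ≡ L (suc k)
    same = same-letter not-start
    2≤SA[1+k] : 2 ≤ SA (suc k)
    2≤SA[1+k] = same-letter⇒2≤SA (s≤s z≤n) (<⇒≤ 2+k≤n) (s≤s z≤n) 2+k≤n (≢-sym 1+n≢n) (sym same)
    b : ℕ
    b = isa (SA (suc k) ∸ 1)
    b-preimage : Preimage SA n (SA (suc k) ∸ 1) b
    b-preimage = isa-pred 2≤SA[1+k] (proj₂ (SA-maps _ (s≤s z≤n) (<⇒≤ 2+k≤n)))
    isa[j∸1]≡ : isa (j ∸ 1) ≡ suc b
    isa[j∸1]≡ = trans (cong (λ i → isa (i ∸ 1)) (sym SA[2+k]≡j)) (LF-neighbours (s≤s z≤n) 2+k≤n same)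

  starts-run-at-isa1 : isRunStart L (isa 1) ≡ true
  starts-run-at-isa1 with isa 1 | isa-preimage 1 ≤-refl 1≤n
  ... | suc zero | _ = refl
  ... | suc (suc k) | _ , 2+k≤n , SA[2+k]≡1 = cong not (dec-false (L (suc (suc k)) ≟ L (suc k)) differ)
    where
    differ : L (suc (suc k)) ≢ L (suc k)
    differ same = contradiction SA[2+k]≡1
      (>⇒≢ (same-letter⇒2≤SA (s≤s z≤n) 2+k≤n (s≤s z≤n) (<⇒≤ 2+k≤n) 1+n≢n same))

  runStartPositions : List ℕ
  runStartPositions = map SA (runStarts n L)

  P : List ℕ
  P = pPlus n T SA

  P↭ : runStartPositions ↭ P
  P↭ = ↭-sym (sort-↭ runStartPositions)

  P-in-range : All (λ i → 1 ≤ i × i ≤ n) P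
  P-in-range = All-resp-↭ P↭ (Allₚ.map⁺ (Allₚ.filter⁺ (Bool.T? ∘ isRunStart L)
    (Allₚ.applyUpTo⁺₁ suc n λ i<n → SA-maps _ (s≤s z≤n) i<n)))

  P-distinct : AllPairs _≢_ P
  P-distinct = Unique-resp-↭ (↭⇒↭ₛ P↭) (AllPairsₚ.map⁺ (AllPairsₚ.filter⁺ (Bool.T? ∘ isRunStart L)
    (AllPairsₚ.applyUpTo⁺₁ suc n λ i<j j<n → λ eq →
      <⇒≢ (s≤s i<j) (SA-injective _ _ (s≤s z≤n) (<-trans i<j j<n) (s≤s z≤n) j<n eq))))

  P-increasing : AllPairs _<_ P
  P-increasing = AllPairs.zipWith (λ (x≤y , x≢y) → ≤∧≢⇒< x≤y x≢y)
    (Sorted⇒AllPairs (DecTotalOrder.totalOrder ≤-decTotalOrder) (sort-↗ runStartPositions) , P-distinct)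

  run-start∈P : ∀ k → 1 ≤ k → k ≤ n → isRunStart L k ≡ true → SA k ∈ P
  run-start∈P (suc k) _ 1+k≤n starts = Any-resp-↭ P↭ (∈-map⁺ SA
    (∈-filter⁺ (Bool.T? ∘ isRunStart L) (∈-applyUpTo⁺ suc 1+k≤n) (subst Bool.T (sym starts) _)))

  I : List (ℕ × ℕ)
  I = Iphi n T SA

  I-in-range : All (λ e → 1 ≤ proj₁ e × proj₁ e ≤ n) I
  I-in-range = Allₚ.map⁺ P-in-range

  I-increasing : AllPairs (λ e e′ → proj₁ e < proj₁ e′) I
  I-increasing = AllPairsₚ.map⁺ P-increasing

  I-graph : All (λ e → proj₂ e ≡ φ (proj₁ e)) I
  I-graph = Allₚ.map⁺ (All.universal (λ _ → refl) P)

  boundary-of-run-start : ∀ {i} → 1 ≤ i → i ≤ n → isRunStart L (isa i) ≡ true →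
    Σ ℕ λ x → 1 ≤ x × x ≤ length I × pOf n I x ≡ i
  boundary-of-run-start {i} 1≤i i≤n starts
    with isa-maps i 1≤i i≤n
  ... | 1≤r , r≤n with ∈⇒at (∈-map⁺ (λ i → i , φ i) (run-start∈P (isa i) 1≤r r≤n starts))
  ...   | x , 1≤x , x≤k , at≡ =
    x , 1≤x , x≤k , trans (pOf-inner n I x≤k) (trans (cong proj₁ at≡) (SA∘isa 1≤i i≤n))

  boundary-at-1 : Σ ℕ λ x → 1 ≤ x × x ≤ length I × pOf n I x ≡ 1
  boundary-at-1 = boundary-of-run-start ≤-refl 1≤n starts-run-at-isa1

  nonempty : 1 ≤ length I
  nonempty = ≤-trans (proj₁ (proj₂ boundary-at-1)) (proj₁ (proj₂ (proj₂ boundary-at-1)))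

  p-in-range : ∀ {x} → 1 ≤ x → x ≤ length I → 1 ≤ pOf n I x × pOf n I x ≤ n
  p-in-range 1≤x x≤k = subst (λ i → 1 ≤ i × i ≤ n) (sym (pOf-inner n I x≤k)) (at-All I-in-range 1≤x x≤k)

  p-< : ∀ {x y} → 1 ≤ x → x < y → y ≤ length I → pOf n I x < pOf n I y
  p-< 1≤x x<y y≤k = subst₂ _<_ (sym (pOf-inner n I (≤-trans (<⇒≤ x<y) y≤k))) (sym (pOf-inner n I y≤k))
    (AllPairs⇒at I-increasing 1≤x x<y y≤k)

  p-first : pOf n I 1 ≡ 1
  p-first with boundary-at-1
  ... | suc zero , _ , _ , p₁≡1 = p₁≡1
  ... | suc (suc x) , _ , 2+x≤k , p≡1 = contradiction
        (subst (pOf n I 1 <_) p≡1 (p-< ≤-refl (s≤s (s≤s z≤n)) 2+x≤k))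
        (≤⇒≯ (proj₁ (p-in-range ≤-refl nonempty)))

  p-increasing : IncreasingOn (suc (length I)) (pOf n I)
  p-increasing x 1≤x x<1+k with m≤n⇒m<n∨m≡n (s≤s⁻¹ x<1+k)
  ... | inj₁ x<k = p-< 1≤x ≤-refl x<k
  ... | inj₂ refl = subst (pOf n I (length I) <_) (sym (pOf-end n I)) (s≤s (proj₂ (p-in-range 1≤x ≤-refl)))

  q≡φ∘p : ∀ x → 1 ≤ x → x ≤ length I → qOf I x ≡ φ (pOf n I x)
  q≡φ∘p x 1≤x x≤k = trans (at-All I-graph 1≤x x≤k) (cong φ (sym (pOf-inner n I x≤k)))

  φ-step-off-boundaries : ∀ j → 2 ≤ j → j ≤ n → Omits (pOf n I) (length I) j → φ j ≡ suc (φ (j ∸ 1))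
  φ-step-off-boundaries j 2≤j j≤n omits with isRunStart L (isa j) in starts?
  ... | false = φ-step j 2≤j j≤n starts?
  ... | true with boundary-of-run-start (≤-trans (s≤s z≤n) 2≤j) j≤n starts?
  ...   | x , 1≤x , x≤k , px≡j = contradiction px≡j (omits x 1≤x x≤k)

lemma4 : (n : ℕ) (T SA : ℕ → ℕ) → IsText n T → IsSuffixArray n T SA →
    IsDisjointIntervalSequence n (Iphi n T SA)
    × Represents n (Iphi n T SA) (phi n SA)
lemma4 n T SA text sa = isDisjoint , represents
  where
  open SuffixArray n T SA text sa
  open IntervalSequence n I φ φ-maps φ-injective nonempty p-first p-increasing q≡φ∘p φ-step-off-boundaries
    using (isDisjoint; represents)
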